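{- Let $\mathfrak M,\mathfrak M'$ be $\omega$-saturated relational pseudo-models, $\mathcal M=\mathcal M(\mathfrak M)=(W,\Sigma,V)$, $\mathcal M'=\mathcal M(\mathfrak M')=(W',\Sigma',V')$, and let $s\subseteq W$, $s'\subseteq W'$ be arbitrary information states (not necessarily represented in the second sorts). If $\mathcal M{\downarrow},s\equiv^{\mathrm{bulk}}_{\mathsf{InqML}}\mathcal M'{\downarrow},s'$, then $\mathcal M{\downarrow},s\sim\mathcal M'{\downarrow},s'$.
   Context: Fix an at most countable set of propositional variables $(p_i)_{i\in I}$. A pseudo-model is $\mathcal M=(W,\Sigma,V)$ with $W\neq\emptyset$, $\Sigma\colon W\to\mathcal P(\mathcal P(W))\setminus\{\emptyset\}$, $V\colon\{p_i\}\to\mathcal P(W)$; it is a model if each $\Sigma(w)$ is closed under subsets; $\sigma(w)=\bigcup\Sigma(w)$. Its inquisitive closure is the model $\mathcal M{\downarrow}=(W,\Sigma{\downarrow},V)$ with $\Sigma{\downarrow}(w)=\{t:t\subseteq s\text{ for some }s\in\Sigma(w)\}$. $\mathsf{InqML}$: $\phi::=p_i\mid\bot\mid(\phi\wedge\phi)\mid(\phi\to\phi)\mid(\phi\mathbin{\backslash\!/}\phi)\mid\Box\phi\mid\boxplus\phi$, support semantics on $s\subseteq W$: $p_i$: $s\subseteq V(p_i)$; $\bot$: $s=\emptyset$; $\wedge$ componentwise; $\phi\to\psi$: for all $t\subseteq s$, $t\models\phi\Rightarrow t\models\psi$; $\phi\mathbin{\backslash\!/}\psi$: $s\models\phi$ or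 $s\models\psi$; $\Box\phi$: $\sigma(w)\models\phi$ for all $w\in s$; $\boxplus\phi$: $t\models\phi$ for all $w\in s$, $t\in\Sigma(w)$. Write $\mathcal M,w$ for $\mathcal M,\{w\}$; $\mathcal M,w\equiv_{\mathsf{InqML}}\mathcal M',w'$ means the same $\mathsf{InqML}$-formulae hold. Bulk equivalence: $\mathcal M,s\equiv^{\mathrm{bulk}}_{\mathsf{InqML}}\mathcal M',s'$ iff every $w\in s$ has some $w'\in s'$ with $\mathcal M,w\equiv_{\mathsf{InqML}}\mathcal M',w'$ and vice versa. Inquisitive bisimulation between models $\mathcal M,\mathcal M'$: a relation $Z\subseteq W\times W'$ such that for all $(w,w')\in Z$: $w\in V(p_i)\Leftrightarrow w'\in V'(p_i)$ for all $i$; for every $t\in\Sigma(w)$ there is $t'\in\Sigma'(w')$ with $t\,\hat Z\,t'$, and for every $t'\in\Sigma'(w')$ there is $t\in\Sigma(w)$ with $t\,\hat Z\,t'$; here $t\,\hat Z\,t'$ means every $v\in t$ has $v'\in t'$ with $(v,v')\in Z$ and every $v'\in t'$ has $v\in t$ with $(v,v')\in Z$. $\mathcal M,s\sim\mathcal M',s'$ iff $s\,\hat Z\,s'$ for some inquisitive bisimulation $Z$; $\mathcal M,w\sim\mathcal M',w'$ iff $(w,w')\in Z$ for some such $Z$. A relational pseudo-model is a two-sorted first-order structure $\mathfrak M=(W,S,\epsilon,E,(P_i)_{i\in I})$, $\epsilon,E\subseteq W\times S$, $P_i\subseteq W$, with extensionality (states with the same $\epsilon$-members are equal) and $E[w]=\{s:(w,s)\in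 E\}\neq\emptyset$; identify $S\subseteq\mathcal P(W)$, $\epsilon$ as membership. $\mathcal M(\mathfrak M)=(W,w\mapsto E[w],p_i\mapsto P_i)$. $\mathfrak M$ is $\omega$-saturated if it realises every type in finitely many free variables over finitely many parameters consistent with its theory with those parameters. -}

module Defs where

open import Level using (Level; 0ℓ) renaming (suc to lsuc)
open import Data.Nat using (ℕ)
open import Data.List using (List; []; _∷_; _++_)
open import Data.List.Relation.Unary.All using (All)
open import Data.Product using (Σ; ∃; ∃-syntax; _×_; _,_)
open import Data.Sum using (_⊎_)
open import Data.Empty using (⊥)
open import Relation.Unary using (Pred; _⊆_)
open import Relation.Binary.PropositionalEquality using (_≡_)
open import Function using (_⇔_; mk⇔)

AtMostCountable : Set → Set
AtMostCountable I = Σ (I → ℕ) λ f → ∀ {i j} → f i ≡ f j → i ≡ j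

record PseudoModel (I : Set) : Set₂ where
  field
    W      : Set
    inhW   : W
    Σ'     : W → Pred (Pred W 0ℓ) (lsuc 0ℓ)
    Σ≠∅    : ∀ w → ∃[ t ] Σ' w t
    V      : I → Pred W 0ℓ

  σ : W → Pred W (lsuc 0ℓ)
  σ w v = ∃[ t ] (Σ' w t × t v)

open PseudoModel public

IsModel : ∀ {I} → PseudoModel I → Set₁
IsModel M = ∀ w t u → Σ' M w t → u ⊆ t → Σ' M w u

_↓ : ∀ {I} → PseudoModel I → PseudoModel I
_↓ M = record
  { W    = W M
  ; inhW = inhW M
  ; Σ'   = λ w t → ∃[ u ] (Σ' M w u × t ⊆ u)
  ; Σ≠∅  = λ w → let (t , h) = Σ≠∅ M w in t , (t , h , λ x → x)
  ; V    = V M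
  }

infixr 6 _∧'_
infixr 5 _⩔_
infixr 4 _⇒_

data InqML (I : Set) : Set where
  atom : I → InqML I
  ⊥'   : InqML I
  _∧'_ : InqML I → InqML I → InqML I
  _⇒_  : InqML I → InqML I → InqML I
  _⩔_  : InqML I → InqML I → InqML I
  □    : InqML I → InqML I
  ⊞    : InqML I → InqML I

-- States are predicates on W; the support
-- relation is level-polymorphic in the state so that σ(w) (a predicate
-- at level 1) can itself be used as a state.  In φ ⇒ ψ the substates t ⊆ s
-- range over predicates of the same level as s.

infix 3 _▸_⊨_

SupLevel : Level → Level
SupLevel ℓ = lsuc (lsuc 0ℓ) Level.⊔ lsuc ℓ

_▸_⊨_ : ∀ {I} (M : PseudoModel I) {ℓ} → Pred (W M) ℓ → InqML I → Set (SupLevel ℓ)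
M ▸ s ⊨ atom i  = Level.Lift _ (s ⊆ V M i)
M ▸ s ⊨ ⊥'      = Level.Lift _ (∀ w → s w → ⊥)
M ▸ s ⊨ φ ∧' ψ  = (M ▸ s ⊨ φ) × (M ▸ s ⊨ ψ)
_▸_⊨_ M {ℓ} s (φ ⇒ ψ) = ∀ (t : Pred (W M) ℓ) → t ⊆ s → M ▸ t ⊨ φ → M ▸ t ⊨ ψ
M ▸ s ⊨ φ ⩔ ψ   = (M ▸ s ⊨ φ) ⊎ (M ▸ s ⊨ ψ)
_▸_⊨_ M {ℓ} s (□ φ)    = Level.Lift (lsuc ℓ) (∀ w → s w → M ▸ σ M w ⊨ φ)
_▸_⊨_ M {ℓ} s (⊞ φ)    = Level.Lift (lsuc ℓ) (∀ w → s w → ∀ t → Σ' M w t → M ▸ t ⊨ φ)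

⟨_⟩ : ∀ {A : Set} → A → Pred A 0ℓ
⟨ w ⟩ v = v ≡ w

InqEquiv : ∀ {I} (M M' : PseudoModel I) → W M → W M' → Set (lsuc (lsuc 0ℓ))
InqEquiv M M' w w' = ∀ φ → (M ▸ ⟨ w ⟩ ⊨ φ) ⇔ (M' ▸ ⟨ w' ⟩ ⊨ φ)

BulkEquiv : ∀ {I} (M M' : PseudoModel I) → Pred (W M) 0ℓ → Pred (W M') 0ℓ → Set (lsuc (lsuc 0ℓ))
BulkEquiv M M' s s' =
  (∀ w → s w → ∃[ w' ] (s' w' × InqEquiv M M' w w')) ×
  (∀ w' → s' w' → ∃[ w ] (s w × InqEquiv M M' w w'))

Lifted : ∀ {A B : Set} {z a b} → (A → B → Set z) → Pred A a → Pred B b → Set (z Level.⊔ a Level.⊔ b)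
Lifted {A} {B} Z t t' = (∀ v → t v → ∃[ v' ] (t' v' × Z v v')) × (∀ v' → t' v' → ∃[ v ] (t v × Z v v'))

IsInqBisim : ∀ {I} (M M' : PseudoModel I) → (W M → W M' → Set₁) → Set₁
IsInqBisim M M' Z = ∀ w w' → Z w w' →
  (∀ i → V M i w ⇔ V M' i w') ×
  (∀ t → Σ' M w t → ∃[ t' ] (Σ' M' w' t' × Lifted Z t t')) ×
  (∀ t' → Σ' M' w' t' → ∃[ t ] (Σ' M w t × Lifted Z t t'))

InqBisimilarStates : ∀ {I} (M M' : PseudoModel I) → Pred (W M) 0ℓ → Pred (W M') 0ℓ → Set₂
InqBisimilarStates M M' s s' = ∃[ Z ] (IsInqBisim M M' Z × Lifted Z s s')

record RelPseudoModel (I : Set) : Set₁ where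
  field
    Wr    : Set
    S     : Set
    ε     : Wr → S → Set
    E     : Wr → S → Set
    P     : I → Pred Wr 0ℓ
    inhWr : Wr
    ext   : ∀ s t → (∀ w → ε w s ⇔ ε w t) → s ≡ t
    E≠∅   : ∀ w → ∃[ s ] E w s

open RelPseudoModel public

𝓜 : ∀ {I} → RelPseudoModel I → PseudoModel I
𝓜 𝔐 = record
  { W    = Wr 𝔐
  ; inhW = inhWr 𝔐
  ; Σ'   = λ w t → Level.Lift _ (∃[ s ] (E 𝔐 w s × (∀ v → t v ⇔ ε 𝔐 v s)))
  ; Σ≠∅  = λ w → let (s , h) = E≠∅ 𝔐 w in
                 (λ v → ε 𝔐 v s) , Level.lift (s , h , λ v → mk⇔ (λ x → x) (λ x → x))
  ; V    = P 𝔐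
  }

data Sort : Set where
  𝕨 𝕤 : Sort

⟦_⟧ : ∀ {I} → RelPseudoModel I → Sort → Set
⟦ 𝔐 ⟧ 𝕨 = Wr 𝔐
⟦ 𝔐 ⟧ 𝕤 = S 𝔐

Ctx : Set
Ctx = List Sort

data Var : Ctx → Sort → Set where
  here  : ∀ {Γ σ} → Var (σ ∷ Γ) σ
  there : ∀ {Γ σ τ} → Var Γ σ → Var (τ ∷ Γ) σ

data FO (I : Set) (Γ : Ctx) : Set where
  _ε̇_   : Var Γ 𝕨 → Var Γ 𝕤 → FO I Γ
  Ė     : Var Γ 𝕨 → Var Γ 𝕤 → FO I Γ
  Ṗ     : I → Var Γ 𝕨 → FO I Γ
  _≐_   : ∀ {σ} → Var Γ σ → Var Γ σ → FO I Γ
  ⊥̇     : FO I Γ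
  _∧̇_ _∨̇_ _→̇_ : FO I Γ → FO I Γ → FO I Γ
  ∀̇ ∃̇   : ∀ σ → FO I (σ ∷ Γ) → FO I Γ

Env : ∀ {I} → RelPseudoModel I → Ctx → Set
Env 𝔐 Γ = ∀ {σ} → Var Γ σ → ⟦ 𝔐 ⟧ σ

_∷ₑ_ : ∀ {I} {𝔐 : RelPseudoModel I} {Γ σ} → ⟦ 𝔐 ⟧ σ → Env 𝔐 Γ → Env 𝔐 (σ ∷ Γ)
(a ∷ₑ ρ) here      = a
(a ∷ₑ ρ) (there x) = ρ x

_⊕_ : ∀ {I} {𝔐 : RelPseudoModel I} {Γ Δ} → Env 𝔐 Γ → Env 𝔐 Δ → Env 𝔐 (Γ ++ Δ)
_⊕_ {Γ = []}    ρ η x = η x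
_⊕_ {Γ = σ ∷ Γ} ρ η here      = ρ here
_⊕_ {Γ = σ ∷ Γ} ρ η (there x) = _⊕_ {Γ = Γ} (λ y → ρ (there y)) η x

Sat : ∀ {I} (𝔐 : RelPseudoModel I) {Γ} → Env 𝔐 Γ → FO I Γ → Set
Sat 𝔐 ρ (x ε̇ y)   = ε 𝔐 (ρ x) (ρ y)
Sat 𝔐 ρ (Ė x y)   = E 𝔐 (ρ x) (ρ y)
Sat 𝔐 ρ (Ṗ i x)   = P 𝔐 i (ρ x)
Sat 𝔐 ρ (x ≐ y)   = ρ x ≡ ρ y
Sat 𝔐 ρ ⊥̇         = ⊥
Sat 𝔐 ρ (φ ∧̇ ψ)   = Sat 𝔐 ρ φ × Sat 𝔐 ρ ψ
Sat 𝔐 ρ (φ ∨̇ ψ)   = Sat 𝔐 ρ φ ⊎ Sat 𝔐 ρ ψ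
Sat 𝔐 ρ (φ →̇ ψ)   = Sat 𝔐 ρ φ → Sat 𝔐 ρ ψ
Sat 𝔐 ρ (∀̇ σ φ)   = ∀ (a : ⟦ 𝔐 ⟧ σ) → Sat 𝔐 (a ∷ₑ ρ) φ
Sat 𝔐 ρ (∃̇ σ φ)   = ∃[ a ] Sat 𝔐 (a ∷ₑ ρ) φ

-- A type p in the finitely many free variables Γ over the finitely many
-- parameters a (an assignment to Δ) is a set of formulas in context Γ ++ Δ.
-- It is consistent with Th(𝔐 , a) iff it is finitely satisfiable in 𝔐
-- (Th(𝔐 , a) being complete), and realised iff some tuple b satisfies it.
FinSatType : ∀ {I} (𝔐 : RelPseudoModel I) {Γ Δ} → Env 𝔐 Δ → Pred (FO I (Γ ++ Δ)) 0ℓ → Set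
FinSatType 𝔐 {Γ} {Δ} a p =
  ∀ (φs : List (FO _ (Γ ++ Δ))) → All p φs →
    Σ (Env 𝔐 Γ) λ b → All (Sat 𝔐 (_⊕_ {Γ = Γ} b a)) φs

RealisedType : ∀ {I} (𝔐 : RelPseudoModel I) {Γ Δ} → Env 𝔐 Δ → Pred (FO I (Γ ++ Δ)) 0ℓ → Set
RealisedType 𝔐 {Γ} {Δ} a p = Σ (Env 𝔐 Γ) λ b → (∀ φ → p φ → Sat 𝔐 (_⊕_ {Γ = Γ} b a) φ)

ωSaturated : ∀ {I} → RelPseudoModel I → Set₁
ωSaturated 𝔐 = ∀ (Γ Δ : Ctx) (a : Env 𝔐 Δ) (p : Pred (FO _ (Γ ++ Δ)) 0ℓ) →
  FinSatType 𝔐 {Γ} a p → RealisedType 𝔐 {Γ} a p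

-- A state supports an InqML-formula φ in 𝓜(𝔐)↓ iff one of finitely many first-order
-- formulas (standard translations of the resolutions of φ) holds at each of its worlds, so
-- InqML-equivalence of worlds is a first-order type condition.  ω-saturation then gives the
-- Hennessy–Milner property.  If w ≡ w' and s₀ ∈ E[w], the type of an E-successor x of w'
-- containing witnesses for all formulas witnessed in s₀ is finitely satisfiable, because
-- w and w' agree on ⊞ of disjunctions of negations; and for each v ∈ s₀ the type of a
-- member of x with the theory of v is finitely satisfiable, because x witnesses every
-- finite conjunction true at v.  So equivalence is an inquisitive bisimulation of the
-- closures, and bulk equivalence of s and s' says exactly that it relates them.

module Submission where

open import Defs
open import Level using (0ℓ; Lift; lift; lower) renaming (suc to lsuc)
open import Relation.Unary using (Pred; _⊆_)
open import Axiom.ExcludedMiddle using (ExcludedMiddle)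
open import Axiom.DoubleNegationElimination using (DoubleNegationElimination; em⇒dne)
open import Data.List using (List; []; _∷_; _++_; map; foldr; cartesianProductWith)
open import Data.List.Relation.Unary.Any using (Any; here; there)
import Data.List.Relation.Unary.Any as Any
open import Data.List.Relation.Unary.Any.Properties
  using (cartesianProductWith⁺; cartesianProductWith⁻; ∷↔; ++↔; map↔)
open import Data.List.Relation.Unary.All using (All; []; _∷_; lookupAny; tabulate)
import Data.List.Relation.Unary.All as All
open import Data.Product using (Σ; ∃-syntax; _×_; _,_; proj₁; proj₂; curry; uncurry)
open import Data.Product.Function.NonDependent.Propositional using (_×-⇔_)
open import Data.Sum using (_⊎_; inj₁; inj₂)
open import Data.Sum.Function.Propositional using (_⊎-⇔_)
open import Relation.Nullary using (¬_)
open import Relation.Binary.PropositionalEquality using (_≡_; refl; sym)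
open import Function using (_∘_; id; _⇔_; mk⇔)
open import Function.Bundles using (Equivalence)
open import Function.Properties.Equivalence using ()
  renaming (refl to ⇔-refl; sym to ⇔-sym; trans to ⇔-trans)
open import Function.Properties.Inverse using (↔⇒⇔)
open Equivalence using (to; from)

module _ {a b c p q r} {A : Set a} {B : Set b} {C : Set c}
         {P : Pred A p} {Q : Pred B q} {R : Pred C r} where

  cartesianProductWith⇔ : (f : A → B → C) → (∀ {x y} → R (f x y) ⇔ (P x × Q y)) →
                          ∀ xs ys → Any R (cartesianProductWith f xs ys) ⇔ (Any P xs × Any Q ys)
  cartesianProductWith⇔ f R⇔ xs ys =
    mk⇔ (cartesianProductWith⁻ f (to R⇔) xs ys)
        (uncurry (cartesianProductWith⁺ f (curry (from R⇔))))

Lifted-swap : ∀ {A B : Set} {z z' a b} {Z : B → A → Set z} {Z' : A → B → Set z'}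
              {t : Pred A a} {t' : Pred B b} →
              (∀ {v v'} → Z v' v → Z' v v') → Lifted Z t' t → Lifted Z' t t'
Lifted-swap Z⇒Z' (forth , back) =
  (λ v tv → let (v' , t'v' , z) = back v tv in v' , t'v' , Z⇒Z' z) ,
  (λ v' t'v' → let (v , tv , z) = forth v' t'v' in v , tv , Z⇒Z' z)

module _ {I : Set} where

  ⊤' : InqML I
  ⊤' = ⊥' ⇒ ⊥'

  ⋀ : List (InqML I) → InqML I
  ⋀ = foldr _∧'_ ⊤'

  ⩔¬ : List (InqML I) → InqML I
  ⩔¬ = foldr (λ φ χ → (φ ⇒ ⊥') ⩔ χ) ⊥'

  supports-⋀⇔ : ∀ (M : PseudoModel I) {ℓ} (s : Pred (W M) ℓ) φs →
                (M ▸ s ⊨ ⋀ φs) ⇔ All (M ▸ s ⊨_) φs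
  supports-⋀⇔ M s []       = mk⇔ (λ _ → []) (λ _ _ _ → id)
  supports-⋀⇔ M s (φ ∷ φs) =
    ⇔-trans (⇔-refl ×-⇔ supports-⋀⇔ M s φs) (mk⇔ (uncurry _∷_) λ { (h ∷ hs) → h , hs })

  supports-atom⇔ : ∀ (M : PseudoModel I) {w} i → (M ▸ ⟨ w ⟩ ⊨ atom i) ⇔ V M i w
  supports-atom⇔ M i = mk⇔ (λ { (lift h) → h refl }) (λ h → lift λ { refl → h })

  Witnessed : (M : PseudoModel I) → Pred (W M) 0ℓ → InqML I → Set₂
  Witnessed M t φ = ∃[ v ] (t v × M ▸ ⟨ v ⟩ ⊨ φ)

-- Standard translation

[]ₑ : ∀ {I} {𝔐 : RelPseudoModel I} → Env 𝔐 []
[]ₑ ()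

Sat-cong : ∀ {I} (𝔐 : RelPseudoModel I) {Γ} {ρ ρ' : Env 𝔐 Γ} →
           (∀ {σ} (x : Var Γ σ) → ρ x ≡ ρ' x) → ∀ α → Sat 𝔐 ρ α → Sat 𝔐 ρ' α
Sat-cong 𝔐 ρ≗ρ' (x ε̇ y) h rewrite ρ≗ρ' x | ρ≗ρ' y = h
Sat-cong 𝔐 ρ≗ρ' (Ė x y) h rewrite ρ≗ρ' x | ρ≗ρ' y = h
Sat-cong 𝔐 ρ≗ρ' (Ṗ i x) h rewrite ρ≗ρ' x = h
Sat-cong 𝔐 ρ≗ρ' (x ≐ y) h rewrite ρ≗ρ' x | ρ≗ρ' y = h
Sat-cong 𝔐 ρ≗ρ' (α ∧̇ β) (a , b) = Sat-cong 𝔐 ρ≗ρ' α a , Sat-cong 𝔐 ρ≗ρ' β b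
Sat-cong 𝔐 ρ≗ρ' (α ∨̇ β) (inj₁ a) = inj₁ (Sat-cong 𝔐 ρ≗ρ' α a)
Sat-cong 𝔐 ρ≗ρ' (α ∨̇ β) (inj₂ b) = inj₂ (Sat-cong 𝔐 ρ≗ρ' β b)
Sat-cong 𝔐 ρ≗ρ' (α →̇ β) h a = Sat-cong 𝔐 ρ≗ρ' β (h (Sat-cong 𝔐 (sym ∘ ρ≗ρ') α a))
Sat-cong 𝔐 ρ≗ρ' (∀̇ σ α) h a = Sat-cong 𝔐 (λ { here → refl ; (there x) → ρ≗ρ' x }) α (h a)
Sat-cong 𝔐 ρ≗ρ' (∃̇ σ α) (a , h) = a , Sat-cong 𝔐 (λ { here → refl ; (there x) → ρ≗ρ' x }) α h

⋁ : ∀ {I Γ} → List (FO I Γ) → FO I Γ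
⋁ = foldr _∨̇_ ⊥̇

⊤̇ : ∀ {I Γ} → FO I Γ
⊤̇ = ⊥̇ →̇ ⊥̇

-- One conjunct a →̇ f a for every a ∈ as, for each choice function f : as → bs.
choices : ∀ {I Γ} → List (FO I Γ) → List (FO I Γ) → List (FO I Γ)
choices []       bs = ⊤̇ ∷ []
choices (a ∷ as) bs = cartesianProductWith (λ b c → (a →̇ b) ∧̇ c) bs (choices as bs)

-- u ∈ σ(w), for u and w the two innermost variables
inσ : ∀ {I Γ} → FO I (𝕨 ∷ 𝕨 ∷ Γ)
inσ = ∃̇ 𝕤 (Ė (there (there here)) here ∧̇ (there here ε̇ here))

-- α holds throughout σ(w), resp. throughout x, for w resp. x the innermost variable
throughoutσ : ∀ {I Γ} → FO I (𝕨 ∷ 𝕨 ∷ Γ) → FO I (𝕨 ∷ Γ)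
throughoutσ α = ∀̇ 𝕨 (inσ →̇ α)

throughout : ∀ {I Γ} → FO I (𝕨 ∷ 𝕤 ∷ Γ) → FO I (𝕤 ∷ Γ)
throughout α = ∀̇ 𝕨 ((here ε̇ there here) →̇ α)

resolutions : ∀ {I} → InqML I → ∀ {Γ} → List (FO I (𝕨 ∷ Γ))
resolutions (atom i) = Ṗ i here ∷ []
resolutions ⊥'       = ⊥̇ ∷ []
resolutions (φ ∧' ψ) = cartesianProductWith _∧̇_ (resolutions φ) (resolutions ψ)
resolutions (φ ⇒ ψ)  = choices (resolutions φ) (resolutions ψ)
resolutions (φ ⩔ ψ)  = resolutions φ ++ resolutions ψ
resolutions (□ φ)    = ⋁ (map throughoutσ (resolutions φ)) ∷ []
resolutions (⊞ φ)    = ∀̇ 𝕤 (Ė (there here) here →̇ ⋁ (map throughout (resolutions φ))) ∷ []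

translation : ∀ {I} → InqML I → ∀ {Γ} → FO I (𝕨 ∷ Γ)
translation φ = ⋁ (resolutions φ)

_▸_⊩_ : ∀ {I} (𝔐 : RelPseudoModel I) → Wr 𝔐 → InqML I → Set
𝔐 ▸ w ⊩ φ = Sat 𝔐 (w ∷ₑ []ₑ) (translation φ)

module Translation {I : Set} (𝔐 : RelPseudoModel I) where

  M : PseudoModel I
  M = 𝓜 𝔐 ↓

  members : S 𝔐 → Pred (Wr 𝔐) 0ℓ
  members x v = ε 𝔐 v x

  Σ↓⇔ : ∀ {w} {t : Pred (Wr 𝔐) 0ℓ} → Σ' M w t ⇔ (∃[ x ] (E 𝔐 w x × t ⊆ members x))
  Σ↓⇔ = mk⇔ (λ { (_ , lift (x , e , t₀≈x) , t⊆t₀) → x , e , λ tv → to (t₀≈x _) (t⊆t₀ tv) })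
            (λ { (x , e , t⊆x) → members x , lift (x , e , λ _ → ⇔-refl) , t⊆x })

  σ⇔inσ : ∀ {Γ} {ρ : Env 𝔐 Γ} {u v} → σ M u v ⇔ Sat 𝔐 (v ∷ₑ (u ∷ₑ ρ)) inσ
  σ⇔inσ = mk⇔ (λ { (t , t∈Σ , tv) → let (x , e , t⊆x) = to Σ↓⇔ t∈Σ in x , e , t⊆x tv })
              (λ { (x , e , vx) → members x , from Σ↓⇔ (x , e , id) , vx })

  HoldsOn : ∀ {Γ ℓ} → Env 𝔐 Γ → Pred (Wr 𝔐) ℓ → FO I (𝕨 ∷ Γ) → Set ℓ
  HoldsOn ρ s α = ∀ u → s u → Sat 𝔐 (u ∷ₑ ρ) α

  Sat-⋁ : ∀ {Γ} {ρ : Env 𝔐 Γ} αs → Sat 𝔐 ρ (⋁ αs) ⇔ Any (Sat 𝔐 ρ) αs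
  Sat-⋁ []       = mk⇔ (λ ()) (λ ())
  Sat-⋁ (α ∷ αs) = ⇔-trans (⇔-refl ⊎-⇔ Sat-⋁ αs) (↔⇒⇔ (∷↔ _))

  Sat-⋁-map : ∀ {Γ Δ} {ρ : Env 𝔐 Γ} (f : FO I Δ → FO I Γ) αs →
              Sat 𝔐 ρ (⋁ (map f αs)) ⇔ Any (Sat 𝔐 ρ ∘ f) αs
  Sat-⋁-map f αs = ⇔-trans (Sat-⋁ (map f αs)) (⇔-sym (↔⇒⇔ map↔))

  module _ {Γ ℓ} (ρ : Env 𝔐 Γ) (s : Pred (Wr 𝔐) ℓ) where

    HoldsOn-∧̇ : ∀ {α β} → HoldsOn ρ s (α ∧̇ β) ⇔ (HoldsOn ρ s α × HoldsOn ρ s β)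
    HoldsOn-∧̇ = mk⇔ (λ h → (λ u su → proj₁ (h u su)) , (λ u su → proj₂ (h u su)))
                    (λ { (h , k) u su → h u su , k u su })

    Any-choices : ∀ as bs → Any (HoldsOn ρ s) (choices as bs) ⇔
                  All (λ a → Any (λ b → HoldsOn ρ s (a →̇ b)) bs) as
    Any-choices []       bs = mk⇔ (λ _ → []) (λ _ → here λ _ _ → id)
    Any-choices (a ∷ as) bs =
      ⇔-trans (cartesianProductWith⇔ _ (λ {b} {c} → HoldsOn-∧̇ {a →̇ b} {c}) bs (choices as bs))
      (⇔-trans (⇔-refl ×-⇔ Any-choices as bs) (mk⇔ (uncurry _∷_) λ { (h ∷ hs) → h , hs }))

    -- The intuitionistic implication is tested on the substates s ∩ a, one per resolution a.
    implication⇔ : ∀ {ℓ'} {A B : Pred (Pred (Wr 𝔐) ℓ) ℓ'} as bs →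
                   (∀ t → A t ⇔ Any (HoldsOn ρ t) as) → (∀ t → B t ⇔ Any (HoldsOn ρ t) bs) →
                   (∀ t → t ⊆ s → A t → B t) ⇔ All (λ a → Any (λ b → HoldsOn ρ s (a →̇ b)) bs) as
    implication⇔ as bs A⇔ B⇔ = mk⇔
      (λ h → tabulate λ {a} a∈as →
        let t = λ u → s u × Sat 𝔐 (u ∷ₑ ρ) a
            At = from (A⇔ t) (Any.map (λ { refl u tu → proj₂ tu }) a∈as)
        in Any.map (λ hb u su sa → hb u (su , sa)) (to (B⇔ t) (h t (λ {u} → proj₁) At)))
      (λ hs t t⊆s At →
        let (hb , ha) = lookupAny hs (to (A⇔ t) At)
        in from (B⇔ t) (Any.map (λ h u tu → h u (t⊆s tu) (ha u tu)) hb))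

  support⇔ : ∀ φ {Γ} (ρ : Env 𝔐 Γ) {ℓ} (s : Pred (Wr 𝔐) ℓ) →
             (M ▸ s ⊨ φ) ⇔ Any (HoldsOn ρ s) (resolutions φ)
  support⇔ (atom i) ρ s = mk⇔ (λ { (lift h) → here λ _ → h }) (λ { (here h) → lift (h _) })
  support⇔ ⊥'       ρ s = mk⇔ (λ { (lift h) → here h }) (λ { (here h) → lift h })
  support⇔ (φ ∧' ψ) ρ s =
    ⇔-trans (support⇔ φ ρ s ×-⇔ support⇔ ψ ρ s)
            (⇔-sym (cartesianProductWith⇔ _∧̇_ (λ {a} {b} → HoldsOn-∧̇ ρ s {a} {b})
                                           (resolutions φ) (resolutions ψ)))
  support⇔ (φ ⇒ ψ)  ρ s =
    ⇔-trans (implication⇔ ρ s (resolutions φ) (resolutions ψ) (support⇔ φ ρ) (support⇔ ψ ρ))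
            (⇔-sym (Any-choices ρ s (resolutions φ) (resolutions ψ)))
  support⇔ (φ ⩔ ψ)  ρ s = ⇔-trans (support⇔ φ ρ s ⊎-⇔ support⇔ ψ ρ s) (↔⇒⇔ ++↔)
  support⇔ (□ φ)    ρ s = mk⇔
    (λ { (lift h) → here λ u su →
           from (Sat-⋁-map throughoutσ (resolutions φ))
                (Any.map (λ h v vσ → h v (from (σ⇔inσ {ρ = ρ}) vσ))
                         (to (support⇔ φ (u ∷ₑ ρ) (σ M u)) (h u su))) })
    (λ { (here h) → lift λ u su →
           from (support⇔ φ (u ∷ₑ ρ) (σ M u))
                (Any.map (λ h v vσ → h v (to (σ⇔inσ {ρ = ρ}) vσ))
                         (to (Sat-⋁-map throughoutσ (resolutions φ)) (h u su))) })
  support⇔ (⊞ φ)    ρ s = mk⇔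
    (λ { (lift h) → here λ u su x e →
           from (Sat-⋁-map throughout (resolutions φ))
                (to (support⇔ φ (x ∷ₑ (u ∷ₑ ρ)) (members x))
                    (h u su (members x) (from Σ↓⇔ (x , e , id)))) })
    (λ { (here h) → lift λ u su t t∈Σ →
           let (x , e , t⊆x) = to Σ↓⇔ t∈Σ in
           from (support⇔ φ (x ∷ₑ (u ∷ₑ ρ)) t)
                (Any.map (λ h v tv → h v (t⊆x tv))
                         (to (Sat-⋁-map throughout (resolutions φ)) (h u su x e))) })

  persistent : ∀ φ {ℓ ℓ'} {s : Pred (Wr 𝔐) ℓ} {t : Pred (Wr 𝔐) ℓ'} → t ⊆ s → M ▸ s ⊨ φ → M ▸ t ⊨ φ
  persistent φ {s = s} {t} t⊆s h =
    from (support⇔ φ []ₑ t) (Any.map (λ h u tu → h u (t⊆s tu)) (to (support⇔ φ []ₑ s) h))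

  translation⇔ : ∀ φ {Γ} (η : Env 𝔐 (𝕨 ∷ Γ)) → Sat 𝔐 η (translation φ) ⇔ (M ▸ ⟨ η here ⟩ ⊨ φ)
  translation⇔ φ η =
    ⇔-trans (mk⇔ (Sat-cong 𝔐 (sym ∘ η≗) (translation φ)) (Sat-cong 𝔐 η≗ (translation φ)))
    (⇔-trans (Sat-⋁ (resolutions φ))
    (⇔-sym (⇔-trans (support⇔ φ (η ∘ there) ⟨ η here ⟩)
                    (mk⇔ (Any.map λ h → h _ refl) (Any.map λ { h _ refl → h })))))
    where
    η≗ : ∀ {σ} (x : Var _ σ) → (η here ∷ₑ (η ∘ there)) x ≡ η x
    η≗ here      = refl
    η≗ (there x) = refl

  ⊩⇔ : ∀ φ {v} → (𝔐 ▸ v ⊩ φ) ⇔ (M ▸ ⟨ v ⟩ ⊨ φ)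
  ⊩⇔ φ {v} = translation⇔ φ (v ∷ₑ []ₑ)

  supports-¬⇔ : ∀ φ (t : Pred (Wr 𝔐) 0ℓ) → (M ▸ t ⊨ (φ ⇒ ⊥')) ⇔ (∀ v → t v → ¬ (M ▸ ⟨ v ⟩ ⊨ φ))
  supports-¬⇔ φ t = mk⇔
    (λ h v tv hv → lower (h ⟨ v ⟩ (λ { refl → tv }) hv) v refl)
    (λ g u u⊆t hu → lift λ v uv → g v (u⊆t uv) (persistent φ (λ { refl → uv }) hu))

  ¬supports-⩔¬ : ∀ t φs → ∃[ v ] t v → All (Witnessed M t) φs → ¬ (M ▸ t ⊨ ⩔¬ φs)
  ¬supports-⩔¬ t []       (v , tv) _                   (lift h) = h v tv
  ¬supports-⩔¬ t (φ ∷ φs) _        ((v , tv , hv) ∷ _) (inj₁ h) = to (supports-¬⇔ φ t) h v tv hv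
  ¬supports-⩔¬ t (φ ∷ φs) inhabited (_ ∷ ws)          (inj₂ h) = ¬supports-⩔¬ t φs inhabited ws h

  ¬supports-⩔¬⇒witnesses : DoubleNegationElimination (lsuc (lsuc 0ℓ)) →
                            ∀ t φs → ¬ (M ▸ t ⊨ ⩔¬ φs) → All (Witnessed M t) φs
  ¬supports-⩔¬⇒witnesses dne t []       _ = []
  ¬supports-⩔¬⇒witnesses dne t (φ ∷ φs) n =
    dne (λ ¬w → n (inj₁ (from (supports-¬⇔ φ t) λ v tv hv → ¬w (v , tv , hv))))
    ∷ ¬supports-⩔¬⇒witnesses dne t φs (n ∘ inj₂)

-- Realising types

module _ {I : Set} {Γ : Ctx} (α : FO I Γ) (G : Pred (InqML I) 0ℓ) (F : InqML I → FO I Γ) where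

  TheoryType : Pred (FO I Γ) 0ℓ
  TheoryType ψ = ψ ≡ α ⊎ ∃[ φ ] (G φ × ψ ≡ F φ)

  TheoryType-finite : ∀ ψs → All TheoryType ψs →
                      ∃[ φs ] (All G φs × (∀ {P : Pred (FO I Γ) 0ℓ} → P α → All (P ∘ F) φs → All P ψs))
  TheoryType-finite []       []                           = [] , [] , λ _ _ → []
  TheoryType-finite (_ ∷ ψs) (inj₁ refl ∷ ts)             =
    let (φs , gs , implied) = TheoryType-finite ψs ts in φs , gs , λ pα pF → pα ∷ implied pα pF
  TheoryType-finite (_ ∷ ψs) (inj₂ (φ , g , refl) ∷ ts)   =
    let (φs , gs , implied) = TheoryType-finite ψs ts in
    φ ∷ φs , g ∷ gs , λ { pα (pφ ∷ pF) → pφ ∷ implied pα pF }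

realiseTheoryType : ∀ {I} {𝔐 : RelPseudoModel I} → ωSaturated 𝔐 →
  ∀ {Γ Δ} (a : Env 𝔐 Δ) α G (F : InqML I → FO I (Γ ++ Δ)) →
  (∀ φs → All G φs → Σ (Env 𝔐 Γ) λ b →
     Sat 𝔐 (_⊕_ {Γ = Γ} b a) α × All (Sat 𝔐 (_⊕_ {Γ = Γ} b a) ∘ F) φs) →
  Σ (Env 𝔐 Γ) λ b → Sat 𝔐 (_⊕_ {Γ = Γ} b a) α × (∀ φ → G φ → Sat 𝔐 (_⊕_ {Γ = Γ} b a) (F φ))
realiseTheoryType {𝔐 = 𝔐} sat {Γ} {Δ} a α G F finite =
  let (b , realises) = sat Γ Δ a (TheoryType α G F) finitelySatisfiable
  in b , realises α (inj₁ refl) , λ φ g → realises (F φ) (inj₂ (φ , g , refl))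
  where
  finitelySatisfiable : FinSatType 𝔐 {Γ} a (TheoryType α G F)
  finitelySatisfiable ψs ts =
    let (φs , gs , implied) = TheoryType-finite α G F ψs ts
        (b , sα , sF) = finite φs gs
    in b , implied sα sF

-- Saturation

module Saturation {I : Set} (em : ExcludedMiddle (lsuc (lsuc 0ℓ)))
                  (𝔐 𝔐' : RelPseudoModel I) (sat' : ωSaturated 𝔐') where

  open Translation 𝔐
  module T' = Translation 𝔐'
  open T' using () renaming (M to M'; members to members')

  dne : DoubleNegationElimination (lsuc (lsuc 0ℓ))
  dne = em⇒dne em

  -- At a world, φ ⇒ ⊥' is classical negation, so the converse is forward transfer of φ ⇒ ⊥'.
  forward⇒InqEquiv : ∀ {v v'} → (∀ φ → M ▸ ⟨ v ⟩ ⊨ φ → M' ▸ ⟨ v' ⟩ ⊨ φ) → InqEquiv M M' v v'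
  forward⇒InqEquiv {v} {v'} forward φ = mk⇔ (forward φ) λ h' → dne λ ¬h →
    to (T'.supports-¬⇔ φ ⟨ v' ⟩) (forward (φ ⇒ ⊥') (from (supports-¬⇔ φ ⟨ v ⟩) λ { _ refl → ¬h }))
       v' refl h'

  -- s₀ ∈ Σ(w) refutes ⊞ (⩔¬ φs) at w, hence some t ∈ Σ'(w') does not support ⩔¬ φs.
  witnessingSuccessor : ∀ {w w' s₀} → InqEquiv M M' w w' → E 𝔐 w s₀ →
    ∀ φs → All (Witnessed M (members s₀)) φs → ∃[ x ] (E 𝔐' w' x × All (Witnessed M' (members' x)) φs)
  witnessingSuccessor {w' = w'} _ _ [] [] = let (x , e) = E≠∅ 𝔐' w' in x , e , []
  witnessingSuccessor {w} {w'} {s₀} w≡w' e (φ ∷ φs) ws@((v , v∈s₀ , _) ∷ _) =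
    let (t , t∈Σ , t⊭χ) = refuting
        (x , e' , t⊆x) = to T'.Σ↓⇔ t∈Σ
    in x , e' , All.map (λ { (v' , tv' , h) → v' , t⊆x tv' , h })
                        (T'.¬supports-⩔¬⇒witnesses dne t (φ ∷ φs) t⊭χ)
    where
    χ = ⩔¬ (φ ∷ φs)

    w'⊭⊞χ : ¬ (M' ▸ ⟨ w' ⟩ ⊨ ⊞ χ)
    w'⊭⊞χ w'⊨ = ¬supports-⩔¬ (members s₀) (φ ∷ φs) (v , v∈s₀) ws
                 (lower (from (w≡w' (⊞ χ)) w'⊨) w refl (members s₀) (from Σ↓⇔ (s₀ , e , id)))

    refuting : ∃[ t ] (Σ' M' w' t × ¬ (M' ▸ t ⊨ χ))
    refuting = dne λ none → w'⊭⊞χ (lift λ { _ refl t t∈Σ → dne λ t⊭ → none (t , t∈Σ , t⊭) })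

  successor : ∀ {w w' s₀} → InqEquiv M M' w w' → E 𝔐 w s₀ →
    ∃[ x ] (E 𝔐' w' x × ∀ φ → Witnessed M (members s₀) φ → Witnessed M' (members' x) φ)
  successor {w} {w'} {s₀} w≡w' e =
    let (b , e' , realised) = realiseTheoryType sat' (w' ∷ₑ []ₑ) (Ė (there here) here) G witnessedIn
          λ φs gs →
            let (x , e' , ws) = witnessingSuccessor w≡w' e φs
                                  (All.map (λ { {φ} (v , v∈s₀ , h) → v , v∈s₀ , to (⊩⇔ φ) h }) gs)
            in (x ∷ₑ []ₑ) , e' ,
               All.map (λ { {φ} (v' , v'x , h) → v' , v'x , from (T'.translation⇔ φ _) h }) ws
    in b here , e' , λ { φ (v , v∈s₀ , h) →
         let (v' , v'x , h') = realised φ (v , v∈s₀ , from (⊩⇔ φ) h)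
         in v' , v'x , to (T'.translation⇔ φ _) h' }
    where
    G : Pred (InqML I) 0ℓ
    G φ = ∃[ v ] (ε 𝔐 v s₀ × 𝔐 ▸ v ⊩ φ)

    witnessedIn : InqML I → FO I (𝕤 ∷ 𝕨 ∷ [])
    witnessedIn φ = ∃̇ 𝕨 ((here ε̇ there here) ∧̇ translation φ)

  equivalentMember : ∀ {v x} → (∀ φ → M ▸ ⟨ v ⟩ ⊨ φ → Witnessed M' (members' x) φ) →
                     ∃[ v' ] (ε 𝔐' v' x × InqEquiv M M' v v')
  equivalentMember {v} {x} witnessed =
    let (b , v'x , realised) =
          realiseTheoryType sat' (x ∷ₑ []ₑ) (here ε̇ there here) (𝔐 ▸ v ⊩_) (λ φ → translation φ)
          λ φs hs →
            let (v' , v'x , h') =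
                  witnessed (⋀ φs) (from (supports-⋀⇔ M ⟨ v ⟩ φs) (All.map (to (⊩⇔ _)) hs))
            in (v' ∷ₑ []ₑ) , v'x ,
               All.map (from (T'.translation⇔ _ _)) (to (supports-⋀⇔ M' ⟨ v' ⟩ φs) h')
    in b here , v'x , forward⇒InqEquiv λ φ h → to (T'.translation⇔ φ _) (realised φ (from (⊩⇔ φ) h))

  step : ∀ {w w' s₀} → InqEquiv M M' w w' → E 𝔐 w s₀ →
         ∃[ x ] (E 𝔐' w' x × ∀ v → ε 𝔐 v s₀ → ∃[ v' ] (ε 𝔐' v' x × InqEquiv M M' v v'))
  step w≡w' e =
    let (x , e' , transfer) = successor w≡w' e
    in x , e' , λ v v∈s₀ → equivalentMember λ φ h → transfer φ (v , v∈s₀ , h)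

-- Bisimulation

-- A small (Set-valued) presentation of InqML-equivalence, so that it can serve as a bisimulation.
TranslationEquiv : ∀ {I} (𝔐 𝔐' : RelPseudoModel I) → Wr 𝔐 → Wr 𝔐' → Set
TranslationEquiv 𝔐 𝔐' w w' = ∀ φ → (𝔐 ▸ w ⊩ φ) ⇔ (𝔐' ▸ w' ⊩ φ)

InqEquiv⇔TranslationEquiv : ∀ {I} (𝔐 𝔐' : RelPseudoModel I) {w w'} →
  InqEquiv (𝓜 𝔐 ↓) (𝓜 𝔐' ↓) w w' ⇔ TranslationEquiv 𝔐 𝔐' w w'
InqEquiv⇔TranslationEquiv 𝔐 𝔐' = mk⇔
  (λ e φ → ⇔-trans (Translation.⊩⇔ 𝔐 φ) (⇔-trans (e φ) (⇔-sym (Translation.⊩⇔ 𝔐' φ))))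
  (λ e φ → ⇔-trans (⇔-sym (Translation.⊩⇔ 𝔐 φ)) (⇔-trans (e φ) (Translation.⊩⇔ 𝔐' φ)))

TranslationEquiv₁ : ∀ {I} (𝔐 𝔐' : RelPseudoModel I) → Wr 𝔐 → Wr 𝔐' → Set₁
TranslationEquiv₁ 𝔐 𝔐' w w' = Lift (lsuc 0ℓ) (TranslationEquiv 𝔐 𝔐' w w')

module _ {I : Set} (em : ExcludedMiddle (lsuc (lsuc 0ℓ))) where

  TranslationEquiv-forth : ∀ (𝔐 𝔐' : RelPseudoModel I) → ωSaturated 𝔐' → ∀ {w w'} →
    TranslationEquiv 𝔐 𝔐' w w' → ∀ t → Σ' (𝓜 𝔐 ↓) w t →
    ∃[ t' ] (Σ' (𝓜 𝔐' ↓) w' t' × Lifted (TranslationEquiv₁ 𝔐 𝔐') t t')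
  TranslationEquiv-forth 𝔐 𝔐' sat' w≃w' t t∈Σ =
    let (x₀ , e , t⊆x₀) = to (Translation.Σ↓⇔ 𝔐) t∈Σ
        (x , e' , matched) =
          Saturation.step em 𝔐 𝔐' sat' (from (InqEquiv⇔TranslationEquiv 𝔐 𝔐') w≃w') e
        t' = λ v' → ε 𝔐' v' x × ∃[ v ] (t v × TranslationEquiv 𝔐 𝔐' v v')
    in t' , from (Translation.Σ↓⇔ 𝔐') (x , e' , proj₁) ,
       (λ v tv → let (v' , v'x , v≡v') = matched v (t⊆x₀ tv)
                     v≃v' = to (InqEquiv⇔TranslationEquiv 𝔐 𝔐') v≡v'
                 in v' , (v'x , v , tv , v≃v') , lift v≃v') ,
       (λ { v' (_ , v , tv , v≃v') → v , tv , lift v≃v' })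

  TranslationEquiv-isInqBisim : ∀ (𝔐 𝔐' : RelPseudoModel I) → ωSaturated 𝔐 → ωSaturated 𝔐' →
                                IsInqBisim (𝓜 𝔐 ↓) (𝓜 𝔐' ↓) (TranslationEquiv₁ 𝔐 𝔐')
  TranslationEquiv-isInqBisim 𝔐 𝔐' sat sat' w w' (lift w≃w') = atoms , forth , back
    where
    atoms : ∀ i → V (𝓜 𝔐 ↓) i w ⇔ V (𝓜 𝔐' ↓) i w'
    atoms i = ⇔-trans (⇔-sym (supports-atom⇔ (𝓜 𝔐 ↓) i))
              (⇔-trans (from (InqEquiv⇔TranslationEquiv 𝔐 𝔐') w≃w' (atom i))
                       (supports-atom⇔ (𝓜 𝔐' ↓) i))
    forth = TranslationEquiv-forth 𝔐 𝔐' sat' w≃w'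
    back = λ t' t'∈Σ →
      let (t , t∈Σ , t'Zt) = TranslationEquiv-forth 𝔐' 𝔐 sat (λ φ → ⇔-sym (w≃w' φ)) t' t'∈Σ
      in t , t∈Σ , Lifted-swap (λ { (lift e) → lift λ φ → ⇔-sym (e φ) }) t'Zt

lemma5p5 : ExcludedMiddle (lsuc (lsuc 0ℓ)) →
    ∀ {I : Set} → AtMostCountable I →
    (𝔐 𝔐' : RelPseudoModel I) → ωSaturated 𝔐 → ωSaturated 𝔐' →
    (s : Pred (Wr 𝔐) 0ℓ) (s' : Pred (Wr 𝔐') 0ℓ) →
    BulkEquiv ((𝓜 𝔐) ↓) ((𝓜 𝔐') ↓) s s' →
    InqBisimilarStates ((𝓜 𝔐) ↓) ((𝓜 𝔐') ↓) s s'
lemma5p5 em _ 𝔐 𝔐' sat sat' s s' (forth , back) =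
  TranslationEquiv₁ 𝔐 𝔐' , TranslationEquiv-isInqBisim em 𝔐 𝔐' sat sat' ,
  (λ w sw → let (w' , sw' , w≡w') = forth w sw in w' , sw' , lift (to equiv w≡w')) ,
  (λ w' sw' → let (w , sw , w≡w') = back w' sw' in w , sw , lift (to equiv w≡w'))
  where
  equiv = InqEquiv⇔TranslationEquiv 𝔐 𝔐'
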